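{- For $n\ge 1$ let $G_n=(g_{ij})$ be the $n\times n$ matrix with $g_{ij}=1$ for $i<j$, $g_{ii}=0$, $g_{i+1,i}=-1$, and $g_{ij}=0$ for $i>j+1$. For $0\le k\le n$ let $S_{n-k}$ be the sum of all principal minors of order $n-k$ of $G_n$ (with $S_0=1$). Then \[S_{n-k}=\sum_{j_1+j_2+\cdots+j_{k+1}=n-2k-1}f_{j_1}f_{j_2}\cdots f_{j_{k+1}},\] where the sum is over all integer tuples $(j_1,\ldots,j_{k+1})$ with $j_t\ge -1$ for all $t$ and $j_1+\cdots+j_{k+1}=n-2k-1$.
   Context: Fibonacci numbers: $f_{ -1}=1$, $f_0=0$, $f_1=1$, $f_{m+1}=f_m+f_{m-1}$. A principal minor of order $n-k$ is the determinant of the submatrix obtained by deleting $k$ rows and the columns with the same indices. -}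

module Defs where

open import Data.Nat as ℕ using (ℕ; zero; suc)
open import Data.Integer as ℤ using (ℤ; +_; -[1+_]; _+_; _*_; _-_; -_; 0ℤ; 1ℤ)
open import Data.Fin as Fin using (Fin; zero; suc; toℕ; punchIn)
open import Data.Fin.Properties using (_<?_)
open import Data.List as List using (List; []; _∷_; map; _++_; concatMap; allFin)
open import Data.Vec.Functional as VF using ()
open import Relation.Nullary using (yes; no)
open import Relation.Binary.PropositionalEquality using (_≡_)

sumℤ : List ℤ → ℤ
sumℤ = List.foldr _+_ 0ℤ

prodℤ : List ℤ → ℤ
prodℤ = List.foldr _*_ 1ℤ

Matrix : ℕ → Set
Matrix n = Fin n → Fin n → ℤ

sign : ℕ → ℤ
sign zero = 1ℤ
sign (suc j) = - sign j

det : (n : ℕ) → Matrix n → ℤ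
det zero A = 1ℤ
det (suc n) A =
  sumℤ (map (λ j → sign (toℕ j) * A zero j * det n (λ r c → A (suc r) (punchIn j c)))
            (allFin (suc n)))

-- All strictly increasing index sequences i_0 < ... < i_{m-1} in Fin n
-- (i.e. all m-element subsets of {0,...,n-1})
choose : (n m : ℕ) → List (Fin m → Fin n)
choose n zero = (λ ()) ∷ []
choose zero (suc m) = []
choose (suc n) (suc m) =
  map (λ v → VF._∷_ zero (λ i → suc (v i))) (choose n m)
  ++ map (λ v i → suc (v i)) (choose n (suc m))

principalSub : {n m : ℕ} → Matrix n → (Fin m → Fin n) → Matrix m
principalSub A s i j = A (s i) (s j)

sumPrincipalMinors : (n : ℕ) → Matrix n → (m : ℕ) → ℤ
sumPrincipalMinors n A m = sumℤ (map (λ s → det m (principalSub A s)) (choose n m))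

-- The matrix G_n (0-based indices; the condition i = j+1 is the same as for 1-based)
G : (n : ℕ) → Matrix n
G n i j with i Fin.<? j
... | yes _ = 1ℤ
... | no _ with toℕ i ℕ.≟ suc (toℕ j)
...   | yes _ = ℤ.-1ℤ
...   | no _ = 0ℤ

S : (n m : ℕ) → ℤ
S n m = sumPrincipalMinors n (G n) m

fibℕ : ℕ → ℕ
fibℕ zero = 0
fibℕ (suc zero) = 1
fibℕ (suc (suc m)) = fibℕ (suc m) ℕ.+ fibℕ m

-- Extended to negative indices by the same recurrence: f_{-m} = (-1)^{m+1} f_m;
-- in particular f_{-1} = 1 (only f_{-1} is used below).
fib : ℤ → ℤ
fib (+ m) = + fibℕ m
fib -[1+ m ] = sign m * + fibℕ (suc m)

weakComp : (p t : ℕ) → List (List ℕ)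
weakComp zero zero = [] ∷ []
weakComp zero (suc t) = []
weakComp (suc p) t =
  concatMap (λ a → map (λ rest → toℕ a ∷ rest) (weakComp p (t ℕ.∸ toℕ a))) (allFin (suc t))

-- All integer tuples (j_1,...,j_p) with every j_t ≥ -1 and j_1+...+j_p = s.
-- Obtained from weak compositions of s+p into p parts by subtracting 1 from each part.
tuplesGE-1 : (p : ℕ) → ℤ → List (List ℤ)
tuplesGE-1 p s with s + + p
... | + t = map (map (λ i → + i - 1ℤ)) (weakComp p t)
... | -[1+ _ ] = []

fibConvolution : (p : ℕ) → ℤ → ℤ
fibConvolution p s = sumℤ (map (λ js → prodℤ (map fib js)) (tuplesGE-1 p s))

-- A principal submatrix of G_n again has ones above the diagonal and zeros on it, and its subdiagonal records
-- which consecutive chosen indices are adjacent: −1 where they are, 0 where they are not. A zero on the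
-- subdiagonal makes the matrix block upper triangular, and expanding along the first row shows that the block of
-- size L with subdiagonal −1, …, −1 has determinant f_(L−1), because f_(−1) + f_0 + ⋯ + f_(L−3) = f_(L−1).
-- Choosing the n − k indices means removing k, which cuts {1, …, n} into k + 1 runs of chosen indices of lengths
-- L_1, …, L_(k+1) ≥ 0 summing to n − k; the minor is f_(L_1 − 1) ⋯ f_(L_(k+1) − 1), and j_t = L_t − 1 gives the
-- tuples of the theorem. The proof scans the indices from left to right, keeping the length of the current run.

module Submission where

open import Defs
open import Data.Fin as Fin using (Fin; zero; suc; toℕ; punchIn; punchOut; _↑ˡ_; _↑ʳ_)
open import Data.Fin.Properties using (toℕ<n; toℕ-↑ˡ; toℕ-↑ʳ; punchIn-punchOut; _<?_)
open import Data.Product using (_×_; _,_)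
open import Data.Integer as ℤ using (ℤ; +_; _+_; _*_; _-_; -_; 0ℤ; 1ℤ; -1ℤ)
import Data.Integer.Properties as ℤ
open import Data.Integer.Solver using (module +-*-Solver)
open import Data.List as List using (List; []; _∷_; map; _++_; concat; allFin)
import Data.List.Properties as List
open import Data.List.Relation.Binary.Pointwise as Pointwise using (Pointwise; []; _∷_)
open import Data.Nat as ℕ using (ℕ; zero; suc; s≤s; z≤n; _≤_; _<_; _∸_)
open import Data.Nat.Induction using (<-wellFounded)
import Data.Nat.Properties as ℕ
import Data.Vec.Functional as Vector
open import Function using (_∘_)
open import Induction.WellFounded using (Acc; acc)
open import Relation.Binary.PropositionalEquality
open import Relation.Nullary using (¬_; yes; no; contradiction)
open import Algebra.Properties.Semiring.Sum ℤ.+-*-semiring using (sum; sum-syntax; sum-cong-≗; *-distribʳ-sum)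

open ≡-Reasoning

sum-zero : ∀ {n} {f : Fin n → ℤ} → (∀ i → f i ≡ 0ℤ) → sum f ≡ 0ℤ
sum-zero {zero}  f≡0 = refl
sum-zero {suc n} f≡0 = cong₂ _+_ (f≡0 zero) (sum-zero (f≡0 ∘ suc))

sum-↑ : ∀ m {n} (f : Fin (m ℕ.+ n) → ℤ) → sum f ≡ sum (f ∘ (_↑ˡ n)) + sum (f ∘ (m ↑ʳ_))
sum-↑ zero    f = sym (ℤ.+-identityˡ (sum f))
sum-↑ (suc m) f = trans (cong (_+_ (f zero)) (sum-↑ m (f ∘ suc))) (sym (ℤ.+-assoc (f zero) _ _))

sumℤ-tabulate : ∀ {n} (f : Fin n → ℤ) → sumℤ (List.tabulate f) ≡ sum f
sumℤ-tabulate {zero}  f = refl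
sumℤ-tabulate {suc n} f = cong (_+_ (f zero)) (sumℤ-tabulate (f ∘ suc))

sumℤ-allFin : ∀ n (f : Fin n → ℤ) → sumℤ (map f (allFin n)) ≡ sum f
sumℤ-allFin n f = trans (cong sumℤ (List.map-tabulate (λ i → i) f)) (sumℤ-tabulate f)

sumℤ-++ : ∀ {A : Set} (f : A → ℤ) xs ys → sumℤ (map f (xs ++ ys)) ≡ sumℤ (map f xs) + sumℤ (map f ys)
sumℤ-++ f []       ys = sym (ℤ.+-identityˡ _)
sumℤ-++ f (x ∷ xs) ys = trans (cong (_+_ (f x)) (sumℤ-++ f xs ys)) (sym (ℤ.+-assoc (f x) _ _))

sumℤ-concat : ∀ {A : Set} (f : A → ℤ) xss → sumℤ (map f (concat xss)) ≡ sumℤ (map (sumℤ ∘ map f) xss)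
sumℤ-concat f []         = refl
sumℤ-concat f (xs ∷ xss) = trans (sumℤ-++ f xs (concat xss)) (cong (_+_ (sumℤ (map f xs))) (sumℤ-concat f xss))

sumℤ-*ˡ : ∀ {A : Set} k (f : A → ℤ) xs → sumℤ (map (λ x → k * f x) xs) ≡ k * sumℤ (map f xs)
sumℤ-*ˡ k f []       = sym (ℤ.*-zeroʳ k)
sumℤ-*ˡ k f (x ∷ xs) = trans (cong (_+_ (k * f x)) (sumℤ-*ˡ k f xs)) (sym (ℤ.*-distribˡ-+ k (f x) _))

sumℤ-map-cong : ∀ {A B : Set} (f : B → ℤ) {g : A → B} {h : A → ℤ} → (∀ x → f (g x) ≡ h x) →
                ∀ xs → sumℤ (map f (map g xs)) ≡ sumℤ (map h xs)
sumℤ-map-cong f gh []       = refl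
sumℤ-map-cong f gh (x ∷ xs) = cong₂ _+_ (gh x) (sumℤ-map-cong f gh xs)

sign-*-sign : ∀ n x → sign n * (sign n * x) ≡ x
sign-*-sign zero    x = trans (ℤ.*-identityˡ (1ℤ * x)) (ℤ.*-identityˡ x)
sign-*-sign (suc n) x = begin
  - s * (- s * x)     ≡⟨ cong (- s *_) (sym (ℤ.neg-distribˡ-* s x)) ⟩
  - s * - (s * x)     ≡⟨ sym (ℤ.neg-distribˡ-* s (- (s * x))) ⟩
  - (s * - (s * x))   ≡⟨ cong -_ (sym (ℤ.neg-distribʳ-* s (s * x))) ⟩
  - - (s * (s * x))   ≡⟨ ℤ.neg-involutive _ ⟩
  s * (s * x)         ≡⟨ sign-*-sign n x ⟩
  x                   ∎
  where
  s : ℤ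
  s = sign n

minor : ∀ {n} → Matrix (suc n) → Fin (suc n) → Matrix n
minor A j r c = A (suc r) (punchIn j c)

det-expand : ∀ n (A : Matrix (suc n)) → det (suc n) A ≡ sum (λ j → sign (toℕ j) * A zero j * det n (minor A j))
det-expand n A = sumℤ-allFin (suc n) (λ j → sign (toℕ j) * A zero j * det n (minor A j))

det-cong : ∀ n {A B : Matrix n} → (∀ i j → A i j ≡ B i j) → det n A ≡ det n B
det-cong zero    A≡B = refl
det-cong (suc n) {A} {B} A≡B = begin
  det (suc n) A                                           ≡⟨ det-expand n A ⟩
  sum (λ j → sign (toℕ j) * A zero j * det n (minor A j)) ≡⟨ sum-cong-≗ (λ j → cong₂ (λ x y → sign (toℕ j) * x * y)
                                                               (A≡B zero j) (det-cong n (λ r c → A≡B (suc r) (punchIn j c)))) ⟩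
  sum (λ j → sign (toℕ j) * B zero j * det n (minor B j)) ≡⟨ det-expand n B ⟨
  det (suc n) B                                           ∎

det-zeroColumn : ∀ n (A : Matrix n) k → (∀ i → A i k ≡ 0ℤ) → det n A ≡ 0ℤ
det-zeroColumn (suc n) A k Aik≡0 = trans (det-expand n A) (sum-zero term≡0)
  where
  term≡0 : ∀ j → sign (toℕ j) * A zero j * det n (minor A j) ≡ 0ℤ
  term≡0 j with j Fin.≟ k
  ... | yes refl = begin
    sign (toℕ j) * A zero j * det n (minor A j) ≡⟨ cong (λ x → sign (toℕ j) * x * det n (minor A j)) (Aik≡0 zero) ⟩
    sign (toℕ j) * 0ℤ * det n (minor A j)       ≡⟨ cong (_* det n (minor A j)) (ℤ.*-zeroʳ (sign (toℕ j))) ⟩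
    0ℤ                                          ∎
  ... | no j≢k = trans (cong (sign (toℕ j) * A zero j *_) minor≡0) (ℤ.*-zeroʳ (sign (toℕ j) * A zero j))
    where
    minor≡0 : det n (minor A j) ≡ 0ℤ
    minor≡0 = det-zeroColumn n (minor A j) (punchOut j≢k)
                (λ i → trans (cong (A (suc i)) (punchIn-punchOut j≢k)) (Aik≡0 (suc i)))

det-firstColumn : ∀ n (A : Matrix (suc n)) → (∀ i → A (suc i) zero ≡ 0ℤ) →
                  det (suc n) A ≡ A zero zero * det n (minor A zero)
det-firstColumn n A Ai0≡0 = begin
  det (suc n) A                                                  ≡⟨ det-expand n A ⟩
  1ℤ * A zero zero * det n (minor A zero) + sum (term ∘ suc)     ≡⟨ cong₂ _+_ (cong (_* det n (minor A zero)) (ℤ.*-identityˡ (A zero zero)))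
                                                                      (sum-zero (λ j → trans (cong (coefficient j *_) (minor≡0 j)) (ℤ.*-zeroʳ (coefficient j)))) ⟩
  A zero zero * det n (minor A zero) + 0ℤ                        ≡⟨ ℤ.+-identityʳ _ ⟩
  A zero zero * det n (minor A zero)                             ∎
  where
  term : Fin (suc n) → ℤ
  term j = sign (toℕ j) * A zero j * det n (minor A j)
  coefficient : Fin n → ℤ
  coefficient j = sign (suc (toℕ j)) * A zero (suc j)
  minor≡0 : ∀ j → det n (minor A (suc j)) ≡ 0ℤ
  minor≡0 = minorZero n A Ai0≡0
    where
    minorZero : ∀ m (B : Matrix (suc m)) → (∀ i → B (suc i) zero ≡ 0ℤ) → ∀ j → det m (minor B (suc j)) ≡ 0ℤ
    minorZero (suc m) B Bi0≡0 j = det-zeroColumn (suc m) (minor B (suc j)) zero Bi0≡0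

hess : (ℕ → ℤ) → ℕ → ℕ → ℤ
hess c zero          zero    = 0ℤ
hess c zero          (suc j) = 1ℤ
hess c (suc i)       (suc j) = hess (c ∘ suc) i j
hess c (suc zero)    zero    = c 0
hess c (suc (suc i)) zero    = 0ℤ

Hess : (m : ℕ) → (ℕ → ℤ) → Matrix m
Hess m c i j = hess c (toℕ i) (toℕ j)

Δ : ℕ → (ℕ → ℤ) → ℤ
Δ m c = det m (Hess m c)

hess-cong : ∀ {c c′ : ℕ → ℤ} → (∀ a → c a ≡ c′ a) → ∀ i j → hess c i j ≡ hess c′ i j
hess-cong c≡c′ zero          zero    = refl
hess-cong c≡c′ zero          (suc j) = refl
hess-cong c≡c′ (suc i)       (suc j) = hess-cong (c≡c′ ∘ suc) i j
hess-cong c≡c′ (suc zero)    zero    = c≡c′ 0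
hess-cong c≡c′ (suc (suc i)) zero    = refl

hess-above : ∀ c {i j} → i < j → hess c i j ≡ 1ℤ
hess-above c {zero}  {suc j} _         = refl
hess-above c {suc i} {suc j} (s≤s i<j) = hess-above (c ∘ suc) i<j

hess-subdiagonal : ∀ c j → hess c (suc j) j ≡ c j
hess-subdiagonal c zero    = refl
hess-subdiagonal c (suc j) = hess-subdiagonal (c ∘ suc) j

hess-elsewhere : ∀ c {i j} → ¬ i < j → i ≢ suc j → hess c i j ≡ 0ℤ
hess-elsewhere c {zero}        {zero}  _   _      = refl
hess-elsewhere c {zero}        {suc j} i≮j _      = contradiction (s≤s z≤n) i≮j
hess-elsewhere c {suc i}       {suc j} i≮j i≢1+j  = hess-elsewhere (c ∘ suc) (i≮j ∘ s≤s) (i≢1+j ∘ cong suc)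
hess-elsewhere c {suc zero}    {zero}  _   1≢1    = contradiction refl 1≢1
hess-elsewhere c {suc (suc i)} {zero}  _   _      = refl

Δ-cong : ∀ m {c c′ : ℕ → ℤ} → (∀ a → c a ≡ c′ a) → Δ m c ≡ Δ m c′
Δ-cong m c≡c′ = det-cong m (λ i j → hess-cong c≡c′ (toℕ i) (toℕ j))

shift : ℕ → (ℕ → ℤ) → ℕ → ℤ
shift k c a = c (k ℕ.+ a)

prodFirst : ℕ → (ℕ → ℤ) → ℤ
prodFirst zero    c = 1ℤ
prodFirst (suc u) c = c 0 * prodFirst u (c ∘ suc)

-- The first column of the minor is (c 0, 0, …, 0), and expanding along it leaves a minor of the same shape.
det-minorHess : ∀ n (j : Fin n) c → det n (minor (Hess (suc n) c) (suc j)) ≡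
                prodFirst (suc (toℕ j)) c * Δ (n ∸ suc (toℕ j)) (shift (suc (suc (toℕ j))) c)
det-minorHess (suc n) zero c = begin
  det (suc n) (minor (Hess (suc (suc n)) c) (suc zero)) ≡⟨ det-firstColumn n (minor (Hess (suc (suc n)) c) (suc zero)) (λ i → refl) ⟩
  c 0 * Δ n (shift 2 c)                                 ≡⟨ cong (_* Δ n (shift 2 c)) (ℤ.*-identityʳ (c 0)) ⟨
  c 0 * 1ℤ * Δ n (shift 2 c)                            ∎
det-minorHess (suc n) (suc j) c = begin
  det (suc n) (minor (Hess (suc (suc n)) c) (suc (suc j))) ≡⟨ det-firstColumn n (minor (Hess (suc (suc n)) c) (suc (suc j))) (λ i → refl) ⟩
  c 0 * det n (minor (Hess (suc n) (c ∘ suc)) (suc j))     ≡⟨ cong (c 0 *_) (det-minorHess n j (c ∘ suc)) ⟩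
  c 0 * (prodFirst (suc (toℕ j)) (c ∘ suc) * Δ′)           ≡⟨ ℤ.*-assoc (c 0) _ Δ′ ⟨
  c 0 * prodFirst (suc (toℕ j)) (c ∘ suc) * Δ′             ∎
  where
  Δ′ : ℤ
  Δ′ = Δ (n ∸ suc (toℕ j)) (shift (suc (suc (suc (toℕ j)))) c)

hessTerm : ℕ → (ℕ → ℤ) → ℕ → ℤ
hessTerm M c t = sign (suc t) * (prodFirst (suc t) c * Δ (M ∸ suc t) (shift (suc (suc t)) c))

-- The first row of Hess is (0, 1, …, 1).
Δ-expand : ∀ M c → Δ (suc M) c ≡ ∑[ j < M ] (hessTerm M c (toℕ j))
Δ-expand M c = begin
  Δ (suc M) c                                            ≡⟨ det-expand M (Hess (suc M) c) ⟩
  0ℤ + (∑[ j < M ] (sign (suc (toℕ j)) * 1ℤ * det M (minor (Hess (suc M) c) (suc j))))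
                                                         ≡⟨ ℤ.+-identityˡ _ ⟩
  ∑[ j < M ] (sign (suc (toℕ j)) * 1ℤ * det M (minor (Hess (suc M) c) (suc j)))
                                                         ≡⟨ sum-cong-≗ (λ j → cong₂ _*_ (ℤ.*-identityʳ (sign (suc (toℕ j))))
                                                                                        (det-minorHess M j c)) ⟩
  ∑[ j < M ] (hessTerm M c (toℕ j))                      ∎

infixr 5 _◂_
_◂_ : ℤ → (ℕ → ℤ) → ℕ → ℤ
(x ◂ c) zero    = x
(x ◂ c) (suc a) = c a

run : ℕ → ℤ → (ℕ → ℤ) → ℕ → ℤ
run zero          b c = c
run (suc zero)    b c = b ◂ c
run (suc (suc L)) b c = -1ℤ ◂ run (suc L) b c

run-suc : ∀ L b c a → run (suc L) b c (suc a) ≡ run L b c a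
run-suc zero    b c a = refl
run-suc (suc L) b c a = refl

shift-run : ∀ k L b c a → shift k (run (k ℕ.+ L) b c) a ≡ run L b c a
shift-run zero    L b c a = refl
shift-run (suc k) L b c a = trans (run-suc (k ℕ.+ L) b c (k ℕ.+ a)) (shift-run k L b c a)

run-◂ : ∀ L b c a → run L -1ℤ (b ◂ c) a ≡ run (suc L) b c a
run-◂ zero          b c a       = refl
run-◂ (suc zero)    b c a       = refl
run-◂ (suc (suc L)) b c zero    = refl
run-◂ (suc (suc L)) b c (suc a) = run-◂ (suc L) b c a

prodFirst-run : ∀ {t L} c → t < L → prodFirst (suc t) (run (suc L) 0ℤ c) ≡ sign (suc t)
prodFirst-run {zero}  {suc L} c t<L       = refl
prodFirst-run {suc t} {suc L} c (s≤s t<L) =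
  trans (ℤ.-1*i≡-i (prodFirst (suc t) (run (suc L) 0ℤ c))) (cong -_ (prodFirst-run c t<L))

prodFirst-run-zero : ∀ L t c → prodFirst (suc (L ℕ.+ t)) (run (suc L) 0ℤ c) ≡ 0ℤ
prodFirst-run-zero zero    t c = refl
prodFirst-run-zero (suc L) t c = cong (-1ℤ *_) (prodFirst-run-zero L t c)

-- fib₋₁ i is the Fibonacci number f_(i − 1).
fib₋₁ : ℕ → ℤ
fib₋₁ zero    = 1ℤ
fib₋₁ (suc i) = + fibℕ i

fib₋₁-suc-suc : ∀ K → fib₋₁ (suc (suc K)) ≡ fib₋₁ (suc K) + fib₋₁ K
fib₋₁-suc-suc zero    = refl
fib₋₁-suc-suc (suc K) = ℤ.pos-+ (fibℕ (suc K)) (fibℕ K)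

sum-fib₋₁ : ∀ K → ∑[ j < K ] (fib₋₁ (K ∸ suc (toℕ j))) ≡ fib₋₁ (suc K)
sum-fib₋₁ zero    = refl
sum-fib₋₁ (suc K) = begin
  fib₋₁ K + (∑[ j < K ] (fib₋₁ (K ∸ suc (toℕ j)))) ≡⟨ cong (_+_ (fib₋₁ K)) (sum-fib₋₁ K) ⟩
  fib₋₁ K + fib₋₁ (suc K)                          ≡⟨ ℤ.+-comm (fib₋₁ K) (fib₋₁ (suc K)) ⟩
  fib₋₁ (suc K) + fib₋₁ K                          ≡⟨ fib₋₁-suc-suc K ⟨
  fib₋₁ (suc (suc K))                              ∎

hessTerm-run : ∀ {t L} m c → t < L →
               hessTerm (L ℕ.+ m) (run (suc L) 0ℤ c) t ≡ Δ (L ∸ suc t ℕ.+ m) (run (L ∸ suc t) 0ℤ c)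
hessTerm-run {t} {L} m c t<L = begin
  sign (suc t) * (prodFirst (suc t) R * Δ (L ℕ.+ m ∸ suc t) (shift (suc (suc t)) R))
      ≡⟨ cong (λ p → sign (suc t) * (p * Δ (L ℕ.+ m ∸ suc t) (shift (suc (suc t)) R))) (prodFirst-run c t<L) ⟩
  sign (suc t) * (sign (suc t) * Δ (L ℕ.+ m ∸ suc t) (shift (suc (suc t)) R))
      ≡⟨ sign-*-sign (suc t) _ ⟩
  Δ (L ℕ.+ m ∸ suc t) (shift (suc (suc t)) R)
      ≡⟨ cong (λ N → Δ N (shift (suc (suc t)) R)) (ℕ.+-∸-comm m t<L) ⟩
  Δ (L ∸ suc t ℕ.+ m) (shift (suc (suc t)) R)
      ≡⟨ Δ-cong (L ∸ suc t ℕ.+ m) restOfRun ⟩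
  Δ (L ∸ suc t ℕ.+ m) (run (L ∸ suc t) 0ℤ c)
      ∎
  where
  R : ℕ → ℤ
  R = run (suc L) 0ℤ c
  restOfRun : ∀ a → shift (suc (suc t)) R a ≡ run (L ∸ suc t) 0ℤ c a
  restOfRun a = trans (cong (λ N → run N 0ℤ c (suc (suc t) ℕ.+ a)) (cong suc (sym (ℕ.m+[n∸m]≡n t<L))))
                      (shift-run (suc (suc t)) (L ∸ suc t) 0ℤ c a)

hessTerm-run-zero : ∀ L m c t → hessTerm (L ℕ.+ m) (run (suc L) 0ℤ c) (L ℕ.+ t) ≡ 0ℤ
hessTerm-run-zero L m c t = begin
  sign (suc (L ℕ.+ t)) * (prodFirst (suc (L ℕ.+ t)) (run (suc L) 0ℤ c) * rest)
      ≡⟨ cong (λ p → sign (suc (L ℕ.+ t)) * (p * rest)) (prodFirst-run-zero L t c) ⟩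
  sign (suc (L ℕ.+ t)) * (0ℤ * rest)
      ≡⟨ ℤ.*-zeroʳ (sign (suc (L ℕ.+ t))) ⟩
  0ℤ  ∎
  where
  rest : ℤ
  rest = Δ (L ℕ.+ m ∸ suc (L ℕ.+ t)) (shift (suc (suc (L ℕ.+ t))) (run (suc L) 0ℤ c))

-- Of the terms in the expansion along the first row only those inside the leading run survive.
Δ-run : ∀ L m c → Δ (L ℕ.+ m) (run L 0ℤ c) ≡ fib₋₁ L * Δ m c
Δ-run L = go L (<-wellFounded L)
  where
  go : ∀ L → Acc _<_ L → ∀ m c → Δ (L ℕ.+ m) (run L 0ℤ c) ≡ fib₋₁ L * Δ m c
  go zero    _         m c = sym (ℤ.*-identityˡ (Δ m c))
  go (suc L) (acc rec) m c = begin
    Δ (suc L ℕ.+ m) (run (suc L) 0ℤ c)                                ≡⟨ Δ-expand (L ℕ.+ m) (run (suc L) 0ℤ c) ⟩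
    ∑[ j < L ℕ.+ m ] (term (toℕ j))                                   ≡⟨ sum-↑ L (term ∘ toℕ) ⟩
    (∑[ j < L ] (term (toℕ (j ↑ˡ m)))) + (∑[ i < m ] (term (toℕ (L ↑ʳ i))))
                                                                      ≡⟨ cong₂ _+_ (sum-cong-≗ {L} insideRun) (sum-zero {m} outsideRun) ⟩
    (∑[ j < L ] (fib₋₁ (L ∸ suc (toℕ j)) * Δ m c)) + 0ℤ              ≡⟨ ℤ.+-identityʳ _ ⟩
    ∑[ j < L ] (fib₋₁ (L ∸ suc (toℕ j)) * Δ m c)                      ≡⟨ *-distribʳ-sum {L} (Δ m c) (λ j → fib₋₁ (L ∸ suc (toℕ j))) ⟨
    (∑[ j < L ] (fib₋₁ (L ∸ suc (toℕ j)))) * Δ m c                    ≡⟨ cong (_* Δ m c) (sum-fib₋₁ L) ⟩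
    fib₋₁ (suc L) * Δ m c                                             ∎
    where
    term : ℕ → ℤ
    term = hessTerm (L ℕ.+ m) (run (suc L) 0ℤ c)
    insideRun : ∀ j → term (toℕ (j ↑ˡ m)) ≡ fib₋₁ (L ∸ suc (toℕ j)) * Δ m c
    insideRun j = begin
      term (toℕ (j ↑ˡ m))                               ≡⟨ cong term (toℕ-↑ˡ j m) ⟩
      term (toℕ j)                                      ≡⟨ hessTerm-run {L = L} m c (toℕ<n j) ⟩
      Δ (L ∸ suc (toℕ j) ℕ.+ m) (run (L ∸ suc (toℕ j)) 0ℤ c)
                                                        ≡⟨ go (L ∸ suc (toℕ j)) (rec (s≤s (ℕ.m∸n≤m L (suc (toℕ j))))) m c ⟩
      fib₋₁ (L ∸ suc (toℕ j)) * Δ m c                   ∎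
    outsideRun : ∀ i → term (toℕ (L ↑ʳ i)) ≡ 0ℤ
    outsideRun i = trans (cong term (toℕ-↑ʳ L i)) (hessTerm-run-zero L m c (toℕ i))

minusOnes : ℕ → ℤ
minusOnes _ = -1ℤ

G-hess : ∀ n (a b : Fin n) → G n a b ≡ hess minusOnes (toℕ a) (toℕ b)
G-hess n a b with a <? b
... | yes a<b = sym (hess-above minusOnes a<b)
... | no  a≮b with toℕ a ℕ.≟ suc (toℕ b)
...   | yes a≡1+b = sym (trans (cong (λ i → hess minusOnes i (toℕ b)) a≡1+b) (hess-subdiagonal minusOnes (toℕ b)))
...   | no  a≢1+b = sym (hess-elsewhere minusOnes a≮b a≢1+b)

extend : ∀ {m n} → (Fin m → Fin n) → Fin (suc m) → Fin (suc n)
extend s = zero Vector.∷ (Fin.suc ∘ s)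

-- The pattern (b , c) describes the index sequence s when the principal submatrix of G on {0} ∪ (1 + s) is
-- Hess (b ◂ c): c is the subdiagonal of the principal submatrix on s, and b = −1 exactly when s starts at 0.
Describes : ∀ {m n} → (Fin m → Fin n) → ℤ × (ℕ → ℤ) → Set
Describes s (b , c) = ∀ i j → hess minusOnes (toℕ (extend s i)) (toℕ (extend s j)) ≡ hess (b ◂ c) (toℕ i) (toℕ j)

patterns : ℕ → ℕ → List (ℤ × (ℕ → ℤ))
patterns n       zero    = (0ℤ , (λ _ → 0ℤ)) ∷ []
patterns zero    (suc m) = []
patterns (suc n) (suc m) =
  map (λ (b , c) → (-1ℤ , b ◂ c)) (patterns n m) ++ map (λ (b , c) → (0ℤ , c)) (patterns n (suc m))

describes-extend : ∀ {m n} {s : Fin m → Fin n} {b c} → Describes s (b , c) → Describes (extend s) (-1ℤ , b ◂ c)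
describes-extend d zero          zero    = refl
describes-extend d zero          (suc j) = refl
describes-extend d (suc i)       (suc j) = d i j
describes-extend d (suc zero)    zero    = refl
describes-extend d (suc (suc i)) zero    = refl

describes-suc : ∀ {m n} {s : Fin (suc m) → Fin n} {b c} → Describes s (b , c) → Describes (Fin.suc ∘ s) (0ℤ , c)
describes-suc d zero          zero    = refl
describes-suc d zero          (suc j) = refl
describes-suc d (suc i)       (suc j) = d (suc i) (suc j)
describes-suc d (suc zero)    zero    = refl
describes-suc d (suc (suc i)) zero    = refl

choose-patterns : ∀ n m → Pointwise Describes (choose n m) (patterns n m)
choose-patterns n       zero    = (λ { zero zero → refl }) ∷ []
choose-patterns zero    (suc m) = []
choose-patterns (suc n) (suc m) =
  Pointwise.++⁺ (Pointwise.map⁺ extend _ (Pointwise.map describes-extend (choose-patterns n m)))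
                (Pointwise.map⁺ (Fin.suc ∘_) _ (Pointwise.map describes-suc (choose-patterns n (suc m))))

principalSub-G : ∀ {m n} {s : Fin m → Fin n} {b c} → Describes s (b , c) → ∀ i j → principalSub (G n) s i j ≡ Hess m c i j
principalSub-G {s = s} d i j = trans (G-hess _ (s i) (s j)) (d (suc i) (suc j))

patterns-empty : ∀ {n m} → n < m → patterns n m ≡ []
patterns-empty {zero}  {suc m} _         = refl
patterns-empty {suc n} {suc m} (s≤s n<m)
  rewrite patterns-empty n<m | patterns-empty (ℕ.m≤n⇒m≤1+n n<m) = refl

-- prefixedMinors n m L is the sum, over the m-subsets s of {0, …, n − 1}, of the principal minors of G_(L+n)
-- on {0, …, L − 1} ∪ (L + s).
prefixedMinors : ℕ → ℕ → ℕ → ℤ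
prefixedMinors n m L = sumℤ (map (λ (b , c) → Δ (L ℕ.+ m) (run L b c)) (patterns n m))

S≡prefixedMinors : ∀ n m → S n m ≡ prefixedMinors n m 0
S≡prefixedMinors n m = cong sumℤ (Pointwise.Pointwise-≡⇒≡
  (Pointwise.map⁺ _ _ (Pointwise.map (det-cong m ∘ principalSub-G) (choose-patterns n m))))

prefixedMinors-zero : ∀ n L → prefixedMinors n 0 L ≡ fib₋₁ L
prefixedMinors-zero n L = begin
  Δ (L ℕ.+ 0) (run L 0ℤ (λ _ → 0ℤ)) + 0ℤ ≡⟨ ℤ.+-identityʳ _ ⟩
  Δ (L ℕ.+ 0) (run L 0ℤ (λ _ → 0ℤ))      ≡⟨ Δ-run L 0 (λ _ → 0ℤ) ⟩
  fib₋₁ L * 1ℤ                           ≡⟨ ℤ.*-identityʳ (fib₋₁ L) ⟩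
  fib₋₁ L                                ∎

prefixedMinors-empty : ∀ {n m} L → n < m → prefixedMinors n m L ≡ 0ℤ
prefixedMinors-empty L n<m rewrite patterns-empty n<m = refl

-- Either 0 ∈ s, which prolongs the leading run, or 0 ∉ s, which closes it with a zero on the subdiagonal.
prefixedMinors-step : ∀ n m L → prefixedMinors (suc n) (suc m) L ≡
                      prefixedMinors n m (suc L) + fib₋₁ L * prefixedMinors n (suc m) 0
prefixedMinors-step n m L = begin
  prefixedMinors (suc n) (suc m) L
    ≡⟨ sumℤ-++ term (map (λ (b , c) → (-1ℤ , b ◂ c)) (patterns n m)) (map (λ (b , c) → (0ℤ , c)) (patterns n (suc m))) ⟩
  sumℤ (map term (map (λ (b , c) → (-1ℤ , b ◂ c)) (patterns n m))) + sumℤ (map term (map (λ (b , c) → (0ℤ , c)) (patterns n (suc m))))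
    ≡⟨ cong₂ _+_ (sumℤ-map-cong term prolong (patterns n m)) (sumℤ-map-cong term close (patterns n (suc m))) ⟩
  prefixedMinors n m (suc L) + sumℤ (map (λ (b , c) → fib₋₁ L * Δ (suc m) c) (patterns n (suc m)))
    ≡⟨ cong (_+_ (prefixedMinors n m (suc L))) (sumℤ-*ˡ (fib₋₁ L) (λ (b , c) → Δ (suc m) c) (patterns n (suc m))) ⟩
  prefixedMinors n m (suc L) + fib₋₁ L * prefixedMinors n (suc m) 0
    ∎
  where
  term : ℤ × (ℕ → ℤ) → ℤ
  term (b , c) = Δ (L ℕ.+ suc m) (run L b c)
  prolong : ∀ ((b , c) : ℤ × (ℕ → ℤ)) → Δ (L ℕ.+ suc m) (run L -1ℤ (b ◂ c)) ≡ Δ (suc L ℕ.+ m) (run (suc L) b c)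
  prolong (b , c) = trans (cong (λ N → Δ N (run L -1ℤ (b ◂ c))) (ℕ.+-suc L m)) (Δ-cong (suc L ℕ.+ m) (run-◂ L b c))
  close : ∀ ((b , c) : ℤ × (ℕ → ℤ)) → Δ (L ℕ.+ suc m) (run L 0ℤ c) ≡ fib₋₁ L * Δ (suc m) c
  close (b , c) = Δ-run L (suc m) c

fibComp : ℕ → ℕ → ℤ
fibComp zero    zero    = 1ℤ
fibComp zero    (suc t) = 0ℤ
fibComp (suc p) t       = ∑[ a < suc t ] (fib₋₁ (toℕ a) * fibComp p (t ∸ toℕ a))

fibCompFrom : ℕ → ℕ → ℕ → ℤ
fibCompFrom L p t = ∑[ a < suc t ] (fib₋₁ (L ℕ.+ toℕ a) * fibComp p (t ∸ toℕ a))

fibComp-zero : ∀ p → fibComp p 0 ≡ 1ℤ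
fibComp-zero zero    = refl
fibComp-zero (suc p) = begin
  1ℤ * fibComp p 0 + 0ℤ ≡⟨ ℤ.+-identityʳ _ ⟩
  1ℤ * fibComp p 0      ≡⟨ ℤ.*-identityˡ _ ⟩
  fibComp p 0           ≡⟨ fibComp-zero p ⟩
  1ℤ                    ∎

fibCompFrom-suc : ∀ L p t → fibCompFrom L p (suc t) ≡ fibCompFrom (suc L) p t + fib₋₁ L * fibComp p (suc t)
fibCompFrom-suc L p t = begin
  fib₋₁ (L ℕ.+ 0) * fibComp p (suc t) + (∑[ a < suc t ] (fib₋₁ (L ℕ.+ suc (toℕ a)) * fibComp p (t ∸ toℕ a)))
    ≡⟨ cong₂ _+_ (cong (λ i → fib₋₁ i * fibComp p (suc t)) (ℕ.+-identityʳ L))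
                 (sum-cong-≗ {suc t} (λ a → cong (λ i → fib₋₁ i * fibComp p (t ∸ toℕ a)) (ℕ.+-suc L (toℕ a)))) ⟩
  fib₋₁ L * fibComp p (suc t) + fibCompFrom (suc L) p t
    ≡⟨ ℤ.+-comm (fib₋₁ L * fibComp p (suc t)) (fibCompFrom (suc L) p t) ⟩
  fibCompFrom (suc L) p t + fib₋₁ L * fibComp p (suc t)
    ∎

prefixedMinors-fibComp : ∀ d m L → prefixedMinors (d ℕ.+ m) m L ≡ fibCompFrom L d m
prefixedMinors-fibComp d zero L = begin
  prefixedMinors (d ℕ.+ 0) 0 L  ≡⟨ prefixedMinors-zero (d ℕ.+ 0) L ⟩
  fib₋₁ L                       ≡⟨ ℤ.*-identityʳ (fib₋₁ L) ⟨
  fib₋₁ L * 1ℤ                  ≡⟨ cong₂ _*_ (cong fib₋₁ (ℕ.+-identityʳ L)) (fibComp-zero d) ⟨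
  fib₋₁ (L ℕ.+ 0) * fibComp d 0 ≡⟨ ℤ.+-identityʳ _ ⟨
  fibCompFrom L d 0             ∎
prefixedMinors-fibComp d (suc m) L = begin
  prefixedMinors (d ℕ.+ suc m) (suc m) L
    ≡⟨ cong (λ n → prefixedMinors n (suc m) L) (ℕ.+-suc d m) ⟩
  prefixedMinors (suc (d ℕ.+ m)) (suc m) L
    ≡⟨ prefixedMinors-step (d ℕ.+ m) m L ⟩
  prefixedMinors (d ℕ.+ m) m (suc L) + fib₋₁ L * prefixedMinors (d ℕ.+ m) (suc m) 0
    ≡⟨ cong₂ _+_ (prefixedMinors-fibComp d m (suc L)) (cong (fib₋₁ L *_) (closedRun d)) ⟩
  fibCompFrom (suc L) d m + fib₋₁ L * fibComp d (suc m)
    ≡⟨ fibCompFrom-suc L d m ⟨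
  fibCompFrom L d (suc m)
    ∎
  where
  closedRun : ∀ d → prefixedMinors (d ℕ.+ m) (suc m) 0 ≡ fibComp d (suc m)
  closedRun zero    = prefixedMinors-empty 0 (ℕ.n<1+n m)
  closedRun (suc d) = trans (cong (λ n → prefixedMinors n (suc m) 0) (sym (ℕ.+-suc d m)))
                            (prefixedMinors-fibComp d (suc m) 0)

fib-pred : ∀ i → fib (+ i - 1ℤ) ≡ fib₋₁ i
fib-pred zero    = refl
fib-pred (suc i) = refl

prodℤ-fib-pred : ∀ l → prodℤ (map fib (map (λ i → + i - 1ℤ) l)) ≡ prodℤ (map fib₋₁ l)
prodℤ-fib-pred []      = refl
prodℤ-fib-pred (i ∷ l) = cong₂ _*_ (fib-pred i) (prodℤ-fib-pred l)

sumℤ-weakComp : ∀ p t → sumℤ (map (prodℤ ∘ map fib₋₁) (weakComp p t)) ≡ fibComp p t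
sumℤ-weakComp zero    zero    = refl
sumℤ-weakComp zero    (suc t) = refl
sumℤ-weakComp (suc p) t = begin
  sumℤ (map P (concat (map parts (allFin (suc t)))))          ≡⟨ sumℤ-concat P (map parts (allFin (suc t))) ⟩
  sumℤ (map (sumℤ ∘ map P) (map parts (allFin (suc t))))      ≡⟨ sumℤ-map-cong (sumℤ ∘ map P) {parts} firstPart (allFin (suc t)) ⟩
  sumℤ (map (λ a → fib₋₁ (toℕ a) * fibComp p (t ∸ toℕ a)) (allFin (suc t)))
                                                             ≡⟨ sumℤ-allFin (suc t) (λ a → fib₋₁ (toℕ a) * fibComp p (t ∸ toℕ a)) ⟩
  fibComp (suc p) t                                          ∎
  where
  P : List ℕ → ℤ
  P = prodℤ ∘ map fib₋₁
  parts : Fin (suc t) → List (List ℕ)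
  parts a = map (toℕ a ∷_) (weakComp p (t ∸ toℕ a))
  firstPart : ∀ a → sumℤ (map P (parts a)) ≡ fib₋₁ (toℕ a) * fibComp p (t ∸ toℕ a)
  firstPart a = begin
    sumℤ (map P (parts a))                                  ≡⟨ sumℤ-map-cong P (λ _ → refl) (weakComp p (t ∸ toℕ a)) ⟩
    sumℤ (map (λ l → fib₋₁ (toℕ a) * P l) (weakComp p (t ∸ toℕ a)))
                                                            ≡⟨ sumℤ-*ˡ (fib₋₁ (toℕ a)) P (weakComp p (t ∸ toℕ a)) ⟩
    fib₋₁ (toℕ a) * sumℤ (map P (weakComp p (t ∸ toℕ a)))   ≡⟨ cong (fib₋₁ (toℕ a) *_) (sumℤ-weakComp p (t ∸ toℕ a)) ⟩
    fib₋₁ (toℕ a) * fibComp p (t ∸ toℕ a)                   ∎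

fibConvolution≡fibComp : ∀ p s t → s + + p ≡ + t → fibConvolution p s ≡ fibComp p t
fibConvolution≡fibComp p s t s+p≡t with s + + p | s+p≡t
... | .(+ t) | refl = begin
  sumℤ (map (prodℤ ∘ map fib) (map (map (λ i → + i - 1ℤ)) (weakComp p t))) ≡⟨ sumℤ-map-cong (prodℤ ∘ map fib) prodℤ-fib-pred (weakComp p t) ⟩
  sumℤ (map (prodℤ ∘ map fib₋₁) (weakComp p t))                            ≡⟨ sumℤ-weakComp p t ⟩
  fibComp p t                                                              ∎

convolutionIndex : ∀ {n k} → k ≤ n → + n - + (2 ℕ.* k) - + 1 + + suc k ≡ + (n ∸ k)
convolutionIndex {n} {k} k≤n = begin
  + n - + (2 ℕ.* k) - + 1 + + suc k   ≡⟨ cong₂ (λ x y → + n - x - + 1 + y) (ℤ.pos-* 2 k) (ℤ.pos-+ 1 k) ⟩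
  + n - + 2 * + k - + 1 + (+ 1 + + k) ≡⟨ solve 2 (λ x y → x :- con (+ 2) :* y :- con (+ 1) :+ (con (+ 1) :+ y) := x :- y) refl (+ n) (+ k) ⟩
  + n - + k                           ≡⟨ ℤ.m-n≡m⊖n n k ⟩
  n ℤ.⊖ k                             ≡⟨ ℤ.⊖-≥ k≤n ⟩
  + (n ∸ k)                           ∎
  where open +-*-Solver

-- The identity also holds for n = 0.
mainTheorem7 : (n k : ℕ) → 1 ≤ n → k ≤ n →
    S n (n ∸ k) ≡ fibConvolution (suc k) (+ n - + (2 ℕ.* k) - + 1)
mainTheorem7 n k _ k≤n = begin
  S n (n ∸ k)                                      ≡⟨ S≡prefixedMinors n (n ∸ k) ⟩
  prefixedMinors n (n ∸ k) 0                       ≡⟨ cong (λ n′ → prefixedMinors n′ (n ∸ k) 0) (ℕ.m+[n∸m]≡n k≤n) ⟨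
  prefixedMinors (k ℕ.+ (n ∸ k)) (n ∸ k) 0         ≡⟨ prefixedMinors-fibComp k (n ∸ k) 0 ⟩
  fibComp (suc k) (n ∸ k)                          ≡⟨ fibConvolution≡fibComp (suc k) (+ n - + (2 ℕ.* k) - + 1) (n ∸ k) (convolutionIndex k≤n) ⟨
  fibConvolution (suc k) (+ n - + (2 ℕ.* k) - + 1) ∎
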